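{- Let $G$ be a forest accessed in the adjacency list model and let $G'$ be obtained from $G$ by the partitioning construction with threshold $s$, accessed via alive-edge queries. Given a vertex $v$ of $G'$ lying in an $s$-rooted tree $T$ of $G'$, there is an algorithm that finds $\mathrm{root}(T)$ using $\mathrm{poly}(s)$ queries.
   Context: Adjacency list model: degree and neighbor queries to $G$. Partitioning construction with threshold $s$: high-degree vertices $V_h$ are those with $\deg_G(v)>s$, low-degree $V_l$ the rest; a component of $G[V_l]$ is large if it has more than $s$ vertices, small otherwise. $G'$ is obtained from $G$ by removing all edges inside $V_h$, removing all edges between $V_h$ and any small component of $G[V_l]$ adjacent to at least two vertices of $V_h$, and removing all edges between $V_h$ and large components of $G[V_l]$. An alive-edge query $(v,i)$ reports whether the $i$-th edge incident to $v$ in $G$ belongs to $G'$. An $s$-rooted tree is a tree $T$ containing a unique vertex $\mathrm{root}(T)$ of degree at least $s+1$ such that every component of $T-\mathrm{root}(T)$ has at most $s$ vertices. -}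

module Defs where

open import Data.Nat using (ℕ; zero; suc; _+_; _*_; _^_; _≤_; _<_; _<?_)
open import Data.Fin using (Fin; fromℕ<)
open import Data.Bool using (Bool; true; false)
open import Data.Maybe using (Maybe; just; nothing)
open import Data.List using (List; []; _∷_; length; _∷ʳ_)
open import Data.List.Relation.Unary.All using (All)
open import Data.List.Relation.Unary.Unique.Propositional using (Unique)
open import Data.List.Relation.Unary.Linked using (Linked)
open import Data.Product using (Σ; ∃; _×_; _,_)
open import Data.Sum using (_⊎_)
open import Relation.Nullary using (¬_; yes; no)
open import Relation.Binary.PropositionalEquality using (_≡_; _≢_)
open import Function.Bundles using (_⇔_)

-- Graphs in the adjacency list model, vertex set Fin n.
-- deg v is the degree, nbr v i the i-th neighbour (0-based).

record Graph (n : ℕ) : Set where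
  field
    deg : Fin n → ℕ
    nbr : (v : Fin n) → Fin (deg v) → Fin n
open Graph public

module _ {n : ℕ} (G : Graph n) where

  Adj : Fin n → Fin n → Set
  Adj u w = ∃ λ (i : Fin (deg G u)) → nbr G u i ≡ w

  record Simple : Set where
    field
      noLoop    : ∀ v (i : Fin (deg G v)) → nbr G v i ≢ v
      noRepeat  : ∀ v (i j : Fin (deg G v)) → nbr G v i ≡ nbr G v j → i ≡ j
      symmetric : ∀ u w → Adj u w → Adj w u

  -- no cycle x, y₁, …, y_k, y with k ≥ 1 (at least 3 distinct vertices)
  Acyclic : Set
  Acyclic = ∀ (x : Fin n) (L : List (Fin n)) (y : Fin n) → 1 ≤ length L →
            Unique (x ∷ L ∷ʳ y) → Linked Adj (x ∷ L ∷ʳ y) → ¬ Adj y x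

  Forest : Set
  Forest = Simple × Acyclic

module Partition {n : ℕ} (s : ℕ) (G : Graph n) where

  High : Fin n → Set
  High v = s < deg G v

  Low : Fin n → Set
  Low v = deg G v ≤ s

  data ReachL : Fin n → Fin n → Set where
    here : ∀ {u} → Low u → ReachL u u
    step : ∀ {u x w} → Low u → Adj G u x → ReachL x w → ReachL u w

  Large : Fin n → Set
  Large u = Σ (List (Fin n)) λ L → Unique L × All (ReachL u) L × s < length L

  Small : Fin n → Set
  Small u = ¬ Large u

  TwoHigh : Fin n → Set
  TwoHigh u = Σ (Fin n) λ h₁ → Σ (Fin n) λ h₂ → Σ (Fin n) λ x₁ → Σ (Fin n) λ x₂ →
              h₁ ≢ h₂ × High h₁ × High h₂ ×
              ReachL u x₁ × Adj G x₁ h₁ × ReachL u x₂ × Adj G x₂ h₂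

  RemovedHL : Fin n → Fin n → Set
  RemovedHL h w = High h × Low w × ((Small w × TwoHigh w) ⊎ Large w)

  Removed : Fin n → Fin n → Set
  Removed u w = (High u × High w) ⊎ RemovedHL u w ⊎ RemovedHL w u

  Edge' : Fin n → Fin n → Set
  Edge' u w = Adj G u w × ¬ Removed u w

  AliveSpec : (Fin n → ℕ → Bool) → Set
  AliveSpec alive =
    (∀ v (i : Fin (deg G v)) → (alive v (Data.Fin.toℕ i) ≡ true) ⇔ Edge' v (nbr G v i)) ×
    (∀ v i → deg G v ≤ i → alive v i ≡ false)

  data Reach' : Fin n → Fin n → Set where
    here : ∀ {u} → Reach' u u
    step : ∀ {u x w} → Edge' u x → Reach' x w → Reach' u w

  data ReachAvoid (r : Fin n) : Fin n → Fin n → Set where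
    here : ∀ {u} → u ≢ r → ReachAvoid r u u
    step : ∀ {u x w} → u ≢ r → Edge' u x → ReachAvoid r x w → ReachAvoid r u w

  DegAtLeast' : ℕ → Fin n → Set
  DegAtLeast' d u = Σ (List (Fin n)) λ L → Unique L × All (Edge' u) L × d ≤ length L

  IsSRootedRoot : Fin n → Fin n → Set
  IsSRootedRoot v r =
    Reach' v r × DegAtLeast' (suc s) r ×
    (∀ u → Reach' v u → DegAtLeast' (suc s) u → u ≡ r) ×
    (∀ u → Reach' v u → u ≢ r → (L : List (Fin n)) → Unique L →
       All (ReachAvoid r u) L → length L ≤ s)

-- Query algorithms (decision trees) with degree, neighbour and
-- alive-edge queries.

data Alg (n : ℕ) (A : Set) : Set where
  ret    : A → Alg n A
  degQ   : Fin n → (ℕ → Alg n A) → Alg n A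
  nbrQ   : Fin n → ℕ → (Maybe (Fin n) → Alg n A) → Alg n A
  aliveQ : Fin n → ℕ → (Bool → Alg n A) → Alg n A

nbrAns : ∀ {n} → Graph n → Fin n → ℕ → Maybe (Fin n)
nbrAns G v i with i <? deg G v
... | yes p = just (nbr G v (fromℕ< p))
... | no _  = nothing

run : ∀ {n A} → Graph n → (Fin n → ℕ → Bool) → Alg n A → A × ℕ
run G al (ret a) = a , 0
run G al (degQ v k) with run G al (k (deg G v))
... | a , c = a , suc c
run G al (nbrQ v i k) with run G al (k (nbrAns G v i))
... | a , c = a , suc c
run G al (aliveQ v i k) with run G al (k (al v i))
... | a , c = a , suc c

-- In G' no edge joins two high vertices, and a low component that keeps an
-- edge to a high vertex h is adjacent to no other high vertex (otherwise all
-- its edges to V_h would have been removed, whether it is small or large).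
-- Hence every component of G' contains at most one high vertex.  The root of
-- an s-rooted tree has more than s neighbours in G', so it is high and is
-- the only high vertex of T.  If v is high it is the root.  Otherwise a
-- breadth-first search of G' from v through low vertices (each has at most s
-- alive edges to probe) stays inside the component of v in T − root(T), which
-- has at most s vertices; so within s rounds it meets a high vertex, namely
-- the root, after O(s³) queries.
module Submission where

open import Defs
open import Data.Nat using (ℕ; zero; suc; _+_; _*_; _^_; _≤_; _<_; _<?_; z≤n; s≤s)
open import Data.Nat.Properties
open import Data.Nat.Solver using (module +-*-Solver)
open import Data.Fin as Fin using (Fin; toℕ; fromℕ<) renaming (_≟_ to _≟F_)
open import Data.Fin.Properties using (injective⇒≤; fromℕ<-toℕ; toℕ<n; toℕ-fromℕ<)
open import Data.Bool using (Bool; true; false; if_then_else_)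
open import Data.Maybe using (Maybe; just; nothing; maybe′)
open import Data.List using (List; []; _∷_; length; upTo; lookup)
open import Data.List.Properties using (length-upTo)
open import Data.List.Relation.Unary.All as All using (All; []; _∷_)
open import Data.List.Relation.Unary.All.Properties using (¬Any⇒All¬)
open import Data.List.Relation.Unary.Any as Any using (Any)
open import Data.List.Relation.Unary.AllPairs using ([]; _∷_)
open import Data.List.Relation.Unary.Unique.Propositional using (Unique)
open import Data.List.Membership.Propositional using (_∈_; _∉_; find)
open import Data.List.Membership.Propositional.Properties using (∈-upTo⁺; ∈-lookup)
open import Data.Product using (Σ; ∃; _×_; _,_; proj₁; proj₂)
open import Data.Sum using (_⊎_; inj₁; inj₂)
open import Data.Empty using (⊥; ⊥-elim)
open import Function using (_∘_)
open import Function.Bundles using (Equivalence)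
open import Relation.Nullary using (¬_; Dec; yes; no; does)
open import Relation.Binary.PropositionalEquality using (_≡_; _≢_; refl; sym; trans; cong; subst)

Unique-lookup-injective : ∀ {A : Set} {xs : List A} → Unique xs →
                          ∀ i j → lookup xs i ≡ lookup xs j → i ≡ j
Unique-lookup-injective (_ ∷ _)   Fin.zero    Fin.zero    _  = refl
Unique-lookup-injective (x∉ ∷ _)  Fin.zero    (Fin.suc j) eq = ⊥-elim (All.lookup x∉ (∈-lookup j) eq)
Unique-lookup-injective (x∉ ∷ _)  (Fin.suc i) Fin.zero    eq = ⊥-elim (All.lookup x∉ (∈-lookup i) (sym eq))
Unique-lookup-injective (_ ∷ u)   (Fin.suc i) (Fin.suc j) eq = cong Fin.suc (Unique-lookup-injective u i j eq)

infixl 1 _>>=_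

_>>=_ : ∀ {n A B} → Alg n A → (A → Alg n B) → Alg n B
ret a        >>= f = f a
degQ v k     >>= f = degQ v (λ d → k d >>= f)
nbrQ v i k   >>= f = nbrQ v i (λ a → k a >>= f)
aliveQ v i k >>= f = aliveQ v i (λ b → k b >>= f)

firstJust : ∀ {n} {B C : Set} → List B → (B → Alg n (Maybe C)) → Alg n (Maybe C)
firstJust []       t = ret nothing
firstJust (b ∷ bs) t = t b >>= maybe′ (ret ∘ just) (firstJust bs t)

module Semantics {n : ℕ} (G : Graph n) (alive : Fin n → ℕ → Bool) where

  output : ∀ {A} → Alg n A → A
  output (ret a)        = a
  output (degQ v k)     = output (k (deg G v))
  output (nbrQ v i k)   = output (k (nbrAns G v i))
  output (aliveQ v i k) = output (k (alive v i))

  cost : ∀ {A} → Alg n A → ℕ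
  cost (ret a)        = 0
  cost (degQ v k)     = suc (cost (k (deg G v)))
  cost (nbrQ v i k)   = suc (cost (k (nbrAns G v i)))
  cost (aliveQ v i k) = suc (cost (k (alive v i)))

  run-≡ : ∀ {A} (m : Alg n A) → run G alive m ≡ (output m , cost m)
  run-≡ (ret a) = refl
  run-≡ (degQ v k) with run G alive (k (deg G v)) | run-≡ (k (deg G v))
  ... | _ | refl = refl
  run-≡ (nbrQ v i k) with run G alive (k (nbrAns G v i)) | run-≡ (k (nbrAns G v i))
  ... | _ | refl = refl
  run-≡ (aliveQ v i k) with run G alive (k (alive v i)) | run-≡ (k (alive v i))
  ... | _ | refl = refl

  output->>= : ∀ {A B} (m : Alg n A) (f : A → Alg n B) → output (m >>= f) ≡ output (f (output m))
  output->>= (ret a)        f = refl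
  output->>= (degQ v k)     f = output->>= (k (deg G v)) f
  output->>= (nbrQ v i k)   f = output->>= (k (nbrAns G v i)) f
  output->>= (aliveQ v i k) f = output->>= (k (alive v i)) f

  cost->>=-≤ : ∀ {A B a b} (m : Alg n A) {f : A → Alg n B} →
               cost m ≤ a → (∀ x → cost (f x) ≤ b) → cost (m >>= f) ≤ a + b
  cost->>=-≤ {a = a} {b} (ret x) _ hf = ≤-trans (hf x) (m≤n+m b a)
  cost->>=-≤ (degQ v k)     (s≤s hm) hf = s≤s (cost->>=-≤ (k (deg G v)) hm hf)
  cost->>=-≤ (nbrQ v i k)   (s≤s hm) hf = s≤s (cost->>=-≤ (k (nbrAns G v i)) hm hf)
  cost->>=-≤ (aliveQ v i k) (s≤s hm) hf = s≤s (cost->>=-≤ (k (alive v i)) hm hf)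

  module _ {B C : Set} where

    firstJust-nothing : ∀ bs (t : B → Alg n (Maybe C)) → output (firstJust bs t) ≡ nothing →
                        All (λ b → output (t b) ≡ nothing) bs
    firstJust-nothing []       t _  = []
    firstJust-nothing (b ∷ bs) t eq
      with output (t b) in tb | output->>= (t b) (maybe′ (ret ∘ just) (firstJust bs t))
    ... | nothing | e = tb ∷ firstJust-nothing bs t (trans (sym e) eq)
    ... | just _  | e with () ← trans (sym e) eq

    firstJust-just : ∀ bs (t : B → Alg n (Maybe C)) {c} → output (firstJust bs t) ≡ just c →
                     Any (λ b → output (t b) ≡ just c) bs
    firstJust-just (b ∷ bs) t eq
      with output (t b) in tb | output->>= (t b) (maybe′ (ret ∘ just) (firstJust bs t))
    ... | nothing | e = Any.there (firstJust-just bs t (trans (sym e) eq))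
    ... | just _  | e = Any.here (trans tb (trans (sym e) eq))

    firstJust-cost : ∀ bs (t : B → Alg n (Maybe C)) {K} → (∀ b → cost (t b) ≤ K) →
                     cost (firstJust bs t) ≤ length bs * K
    firstJust-cost []       t hK = z≤n
    firstJust-cost (b ∷ bs) t {K} hK = cost->>=-≤ (t b) (hK b) continue
      where
        continue : ∀ m → cost (maybe′ (ret ∘ just) (firstJust bs t) m) ≤ length bs * K
        continue nothing  = firstJust-cost bs t hK
        continue (just _) = z≤n

module Adjacency {n : ℕ} (G : Graph n) where

  nbrAns-toℕ : ∀ x (j : Fin (deg G x)) → nbrAns G x (toℕ j) ≡ just (nbr G x j)
  nbrAns-toℕ x j with toℕ j <? deg G x
  ... | yes j< = cong (just ∘ nbr G x) (fromℕ<-toℕ j j<)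
  ... | no j≮  = ⊥-elim (j≮ (toℕ<n j))

  nbrAns-just : ∀ x i {y} → nbrAns G x i ≡ just y → ∃ λ j → toℕ j ≡ i × nbr G x j ≡ y
  nbrAns-just x i eq with i <? deg G x
  nbrAns-just x i refl | yes i< = fromℕ< i< , toℕ-fromℕ< i< , refl

  Unique-Adj⇒length≤deg : ∀ {u L} → Unique L → All (Adj G u) L → length L ≤ deg G u
  Unique-Adj⇒length≤deg {u} {L} uniq adj = injective⇒≤ index-injective
    where
      index : Fin (length L) → Fin (deg G u)
      index k = proj₁ (All.lookup adj (∈-lookup k))

      nbr-index : ∀ k → nbr G u (index k) ≡ lookup L k
      nbr-index k = proj₂ (All.lookup adj (∈-lookup k))

      index-injective : ∀ {i j} → index i ≡ index j → i ≡ j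
      index-injective {i} {j} eq = Unique-lookup-injective uniq i j
        (trans (sym (nbr-index i)) (trans (cong (nbr G u) eq) (nbr-index j)))

module Surviving {n : ℕ} (s : ℕ) (G : Graph n) (Adj-sym : ∀ u w → Adj G u w → Adj G w u) where
  open Partition s G
  open Adjacency G

  Low⇒¬High : ∀ {x} → Low x → ¬ High x
  Low⇒¬High = ≤⇒≯

  Removed-sym : ∀ {u w} → Removed u w → Removed w u
  Removed-sym (inj₁ (hu , hw))  = inj₁ (hw , hu)
  Removed-sym (inj₂ (inj₁ rm)) = inj₂ (inj₂ rm)
  Removed-sym (inj₂ (inj₂ rm)) = inj₂ (inj₁ rm)

  Edge'-sym : ∀ {u w} → Edge' u w → Edge' w u
  Edge'-sym {u} {w} (adj , kept) = Adj-sym u w adj , kept ∘ Removed-sym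

  Reach'-trans : ∀ {a b c} → Reach' a b → Reach' b c → Reach' a c
  Reach'-trans here       q = q
  Reach'-trans (step e p) q = step e (Reach'-trans p q)

  Reach'-sym : ∀ {a b} → Reach' a b → Reach' b a
  Reach'-sym here       = here
  Reach'-sym (step e p) = Reach'-trans (Reach'-sym p) (step (Edge'-sym e) here)

  ReachAvoid⇒Reach' : ∀ {r a b} → ReachAvoid r a b → Reach' a b
  ReachAvoid⇒Reach' (here _)     = here
  ReachAvoid⇒Reach' (step _ e p) = step e (ReachAvoid⇒Reach' p)

  ReachAvoid-snoc : ∀ {r a x y} → ReachAvoid r a x → Edge' x y → y ≢ r → ReachAvoid r a y
  ReachAvoid-snoc (here x≢r)     e y≢r = step x≢r e (here y≢r)
  ReachAvoid-snoc (step a≢r e′ p) e y≢r = step a≢r e′ (ReachAvoid-snoc p e y≢r)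

  ReachL-snoc : ∀ {a x y} → ReachL a x → Adj G x y → Low y → ReachL a y
  ReachL-snoc (here lx)       adj ly = step lx adj (here ly)
  ReachL-snoc (step la adj′ p) adj ly = step la adj′ (ReachL-snoc p adj ly)

  ReachL⇒Low : ∀ {a x} → ReachL a x → Low x
  ReachL⇒Low (here lx)     = lx
  ReachL⇒Low (step _ _ p)  = ReachL⇒Low p

  Reach'-closed : ∀ {S : List (Fin n)} → (∀ {x y} → x ∈ S → Edge' x y → y ∈ S) →
                  ∀ {a b} → Reach' a b → a ∈ S → b ∈ S
  Reach'-closed closed here       a∈ = a∈
  Reach'-closed closed (step e p) a∈ = Reach'-closed closed p (closed a∈ e)

  DegAtLeast'⇒High : ∀ {u} → DegAtLeast' (suc s) u → High u
  DegAtLeast'⇒High (L , uniq , edges , s<L) =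
    ≤-trans s<L (Unique-Adj⇒length≤deg uniq (All.map proj₁ edges))

  Attached : Fin n → Fin n → Set
  Attached h x₀ = High h × Low x₀ × Adj G x₀ h × ¬ RemovedHL h x₀

  Edge'⇒Attached : ∀ {x h} → Edge' x h → Low x → High h → Attached h x
  Edge'⇒Attached (adj , kept) lx hh = hh , lx , adj , kept ∘ inj₂ ∘ inj₂

  Attached⇒¬TwoHigh : ∀ {h x₀} → Attached h x₀ → ¬ TwoHigh x₀
  Attached⇒¬TwoHigh (hh , lx₀ , _ , kept) two =
    kept (hh , lx₀ , inj₁ ((λ large → kept (hh , lx₀ , inj₂ large)) , two))

  attached-reach'-high : ∀ {h x₀ x w} → Attached h x₀ → ReachL x₀ x → Reach' x w → High w → w ≡ h
  high-reach'-high     : ∀ {h w} → High h → Reach' h w → High w → w ≡ h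

  attached-reach'-high att rl here hw = ⊥-elim (Low⇒¬High (ReachL⇒Low rl) hw)
  attached-reach'-high {h} {x₀} {x} att@(hh , lx₀ , adj , _) rl (step {x = y} e p) hw with s <? deg G y
  ... | no y≮ = attached-reach'-high att (ReachL-snoc rl (proj₁ e) (≮⇒≥ y≮)) p hw
  ... | yes hy with y ≟F h
  ...   | yes refl = high-reach'-high hy p hw
  ...   | no y≢h   = ⊥-elim (Attached⇒¬TwoHigh att
            (h , y , x₀ , x , y≢h ∘ sym , hh , hy , here lx₀ , adj , rl , proj₁ e))

  high-reach'-high hh here hw = refl
  high-reach'-high hh (step {x = y} e p) hw with s <? deg G y
  ... | yes hy = ⊥-elim (proj₂ e (inj₁ (hh , hy)))
  ... | no y≮  = attached-reach'-high (Edge'⇒Attached (Edge'-sym e) (≮⇒≥ y≮) hh) (here (≮⇒≥ y≮)) p hw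

data Discovery (n : ℕ) : Set where
  high low : Fin n → Discovery n

module RootSearch (s n : ℕ) where
  open import Data.List.Membership.DecPropositional (_≟F_ {n}) using (_∈?_)

  classify : List (Fin n) → Fin n → ℕ → Maybe (Discovery n)
  classify seen y d with s <? d | y ∈? seen
  ... | yes _ | _     = just (high y)
  ... | no _  | yes _ = nothing
  ... | no _  | no _  = just (low y)

  classify-just : ∀ seen y d {r} → classify seen y d ≡ just r →
                  (r ≡ high y × s < d) ⊎ (r ≡ low y × d ≤ s × y ∉ seen)
  classify-just seen y d eq with s <? d | y ∈? seen
  classify-just seen y d refl | yes s<d | _    = inj₁ (refl , s<d)
  classify-just seen y d refl | no d≯s  | no y∉ = inj₂ (refl , ≮⇒≥ d≯s , y∉)

  classify-nothing : ∀ seen y d → classify seen y d ≡ nothing → y ∈ seen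
  classify-nothing seen y d eq with s <? d | y ∈? seen
  ... | no _ | yes y∈ = y∈

  onNeighbour : List (Fin n) → Maybe (Fin n) → Alg n (Maybe (Discovery n))
  onNeighbour seen = maybe′ (λ y → degQ y (ret ∘ classify seen y)) (ret nothing)

  probe : List (Fin n) → Fin n → ℕ → Alg n (Maybe (Discovery n))
  probe seen x i = aliveQ x i λ a → if a then nbrQ x i (onNeighbour seen) else ret nothing

  scan : List (Fin n) → Fin n → Alg n (Maybe (Discovery n))
  scan seen x = firstJust (upTo s) (probe seen x)

  round : List (Fin n) → Alg n (Maybe (Discovery n))
  round seen = firstJust seen (scan seen)

  -- The fuel f bounds the number of rounds; v is a junk answer.
  explore    : Fin n → ℕ → List (Fin n) → Alg n (Fin n)
  afterRound : Fin n → ℕ → List (Fin n) → Maybe (Discovery n) → Alg n (Fin n)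
  explore v zero    seen = ret v
  explore v (suc f) seen = round seen >>= afterRound v f seen
  afterRound v f seen nothing         = ret v
  afterRound v f seen (just (high h)) = ret h
  afterRound v f seen (just (low y))  = explore v f (y ∷ seen)

  findRoot : Fin n → Alg n (Fin n)
  findRoot v = degQ v λ d → if does (s <? d) then ret v else explore v s (v ∷ [])

module RootSearchCost (s n : ℕ) (G : Graph n) (alive : Fin n → ℕ → Bool) where
  open Semantics G alive
  open RootSearch s n

  probe-cost : ∀ seen x i → cost (probe seen x i) ≤ 3
  probe-cost seen x i with alive x i
  ... | false = s≤s z≤n
  ... | true with nbrAns G x i
  ...   | nothing = s≤s (s≤s z≤n)
  ...   | just _  = s≤s (s≤s (s≤s z≤n))

  round-cost : ∀ seen → cost (round seen) ≤ length seen * (s * 3)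
  round-cost seen = firstJust-cost seen (scan seen) scan-cost
    where
      scan-cost : ∀ x → cost (scan seen x) ≤ s * 3
      scan-cost x with firstJust-cost (upTo s) (probe seen x) (probe-cost seen x)
      ... | c rewrite length-upTo s = c

  explore-cost : ∀ v f seen {B} → length seen + f ≤ B → cost (explore v f seen) ≤ f * (B * (s * 3))
  explore-cost v zero    seen bound = z≤n
  explore-cost v (suc f) seen {B} bound = cost->>=-≤ (round seen)
      (≤-trans (round-cost seen) (*-monoˡ-≤ (s * 3) (≤-trans (m≤m+n (length seen) (suc f)) bound)))
      afterRound-cost
    where
      afterRound-cost : ∀ m → cost (afterRound v f seen m) ≤ f * (B * (s * 3))
      afterRound-cost nothing         = z≤n
      afterRound-cost (just (high _)) = z≤n
      afterRound-cost (just (low y))  = explore-cost v f (y ∷ seen) (≤-trans (≤-reflexive (sym (+-suc _ f))) bound)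

  findRoot-cost : ∀ v → cost (findRoot v) ≤ 4 * suc s ^ 3
  findRoot-cost v = ≤-trans (s≤s (start-cost (s <? deg G v))) cubic
    where
      open +-*-Solver

      start-cost : ∀ {P} (d : Dec P) →
                   cost (if does d then ret v else explore v s (v ∷ [])) ≤ s * (suc s * (s * 3))
      start-cost (yes _) = z≤n
      start-cost (no _)  = explore-cost v s (v ∷ []) ≤-refl

      cubic : suc (s * (suc s * (s * 3))) ≤ 4 * suc s ^ 3
      cubic = +-mono-≤ (m^n>0 (suc s) 3) (begin
        s * (suc s * (s * 3))         ≤⟨ *-mono-≤ (n≤1+n s) (*-monoʳ-≤ (suc s) (*-monoˡ-≤ 3 (n≤1+n s))) ⟩
        suc s * (suc s * (suc s * 3)) ≡⟨ solve 1 (λ t → t :* (t :* (t :* con 3)) := con 3 :* t :^ 3) refl (suc s) ⟩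
        3 * suc s ^ 3                 ∎)
        where open ≤-Reasoning

module RootSearchSound {s n : ℕ} {G : Graph n} {alive : Fin n → ℕ → Bool}
                       (spec : Partition.AliveSpec s G alive) where
  open Partition s G
  open Semantics G alive
  open RootSearch s n
  open Adjacency G

  data Discovered (seen : List (Fin n)) (x : Fin n) : Discovery n → Set where
    high : ∀ {y} → Edge' x y → High y → Discovered seen x (high y)
    low  : ∀ {y} → Edge' x y → Low y → y ∉ seen → Discovered seen x (low y)

  alive-edge : ∀ {x i y} → nbrAns G x i ≡ just y → alive x i ≡ true → Edge' x y
  alive-edge {x} {i} nb al with nbrAns-just x i nb
  ... | j , refl , refl = Equivalence.to (proj₁ spec x j) al

  probe-just : ∀ seen x i {d} → output (probe seen x i) ≡ just d → Discovered seen x d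
  probe-just seen x i eq with alive x i in al
  ... | true = neighbour-just refl eq
    where
      neighbour-just : ∀ {m d} → nbrAns G x i ≡ m → output (onNeighbour seen m) ≡ just d → Discovered seen x d
      neighbour-just {just y} nb eq with classify-just seen y (deg G y) eq
      ... | inj₁ (refl , hy)        = high (alive-edge nb al) hy
      ... | inj₂ (refl , ly , y∉)   = low (alive-edge nb al) ly y∉

  probe-nothing : ∀ seen x (j : Fin (deg G x)) → Edge' x (nbr G x j) →
                  output (probe seen x (toℕ j)) ≡ nothing → nbr G x j ∈ seen
  probe-nothing seen x j e eq with alive x (toℕ j) | Equivalence.from (proj₁ spec x j) e
  ... | true | _ = classify-nothing seen (nbr G x j) (deg G (nbr G x j))
                     (trans (cong (output ∘ onNeighbour seen) (sym (nbrAns-toℕ x j))) eq)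

  round-just : ∀ seen {d} → output (round seen) ≡ just d → ∃ λ x → x ∈ seen × Discovered seen x d
  round-just seen eq with find (firstJust-just seen (scan seen) eq)
  ... | x , x∈ , scan-eq with find (firstJust-just (upTo s) (probe seen x) scan-eq)
  ...   | i , _ , probe-eq = x , x∈ , probe-just seen x i probe-eq

  round-nothing-closed : ∀ {seen} → All Low seen → output (round seen) ≡ nothing →
                         ∀ {x y} → x ∈ seen → Edge' x y → y ∈ seen
  round-nothing-closed {seen} lows eq {x} x∈ e@((j , refl) , _) =
    probe-nothing seen x j e (All.lookup probes-nothing (∈-upTo⁺ (<-≤-trans (toℕ<n j) (All.lookup lows x∈))))
    where
      probes-nothing : All (λ i → output (probe seen x i) ≡ nothing) (upTo s)
      probes-nothing = firstJust-nothing (upTo s) (probe seen x) (All.lookup (firstJust-nothing seen (scan seen) eq) x∈)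

module RootSearchCorrect {s n : ℕ} {G : Graph n} (forest : Forest G)
                         {alive : Fin n → ℕ → Bool} (spec : Partition.AliveSpec s G alive)
                         {v r : Fin n} (isRoot : Partition.IsSRootedRoot s G v r) where
  open Partition s G
  open Semantics G alive
  open RootSearch s n
  open RootSearchSound spec
  open Surviving s G (Simple.symmetric (proj₁ forest))

  v⇝r : Reach' v r
  v⇝r = proj₁ isRoot

  r-high : High r
  r-high = DegAtLeast'⇒High (proj₁ (proj₂ isRoot))

  Low⇒≢r : ∀ {x} → Low x → x ≢ r
  Low⇒≢r lx refl = Low⇒¬High lx r-high

  Explored : List (Fin n) → Set
  Explored seen = Unique seen × All (λ x → Low x × ReachAvoid r v x) seen × v ∈ seen

  -- This is where s-rootedness enters: the component of v in T − r has at most s vertices.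
  Explored⇒length≤s : ∀ {seen} → Explored seen → length seen ≤ s
  Explored⇒length≤s (uniq , reached , v∈) =
    proj₂ (proj₂ (proj₂ isRoot)) v here (Low⇒≢r (proj₁ (All.lookup reached v∈)))
      _ uniq (All.map proj₂ reached)

  round-nothing-impossible : ∀ {seen} → Explored seen → output (round seen) ≢ nothing
  round-nothing-impossible (_ , reached , v∈) eq =
    Low⇒≢r (proj₁ (All.lookup reached r∈)) refl
    where r∈ = Reach'-closed (round-nothing-closed (All.map proj₁ reached) eq) v⇝r v∈

  round-high-root : ∀ {seen h} → Explored seen → output (round seen) ≡ just (high h) → h ≡ r
  round-high-root {seen} (_ , reached , _) eq with round-just seen eq
  ... | x , x∈ , high e hh with All.lookup reached x∈
  ...   | lx , v⇝x = sym (attached-reach'-high (Edge'⇒Attached e lx hh) (here lx)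
                          (Reach'-trans (Reach'-sym (ReachAvoid⇒Reach' v⇝x)) v⇝r) r-high)

  round-low-explored : ∀ {seen y} → Explored seen → output (round seen) ≡ just (low y) → Explored (y ∷ seen)
  round-low-explored {seen} (uniq , reached , v∈) eq with round-just seen eq
  ... | x , x∈ , low e ly y∉ =
    ¬Any⇒All¬ seen y∉ ∷ uniq ,
    (ly , ReachAvoid-snoc (proj₂ (All.lookup reached x∈)) e (Low⇒≢r ly)) ∷ reached ,
    Any.there v∈

  explore-correct : ∀ f seen → Explored seen → s < length seen + f → output (explore v f seen) ≡ r
  explore-correct zero seen ex bound =
    ⊥-elim (<⇒≱ (subst (s <_) (+-identityʳ _) bound) (Explored⇒length≤s ex))
  explore-correct (suc f) seen ex bound =
    trans (output->>= (round seen) (afterRound v f seen)) (afterRound-correct (output (round seen)) refl)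
    where
      afterRound-correct : ∀ m → output (round seen) ≡ m → output (afterRound v f seen m) ≡ r
      afterRound-correct nothing         eq = ⊥-elim (round-nothing-impossible ex eq)
      afterRound-correct (just (high h)) eq = round-high-root ex eq
      afterRound-correct (just (low y))  eq =
        explore-correct f (y ∷ seen) (round-low-explored ex eq) (subst (s <_) (+-suc _ f) bound)

  findRoot-correct : output (findRoot v) ≡ r
  findRoot-correct = start-correct (s <? deg G v)
    where
      start-correct : (high? : Dec (High v)) →
                      output (if does high? then ret v else explore v s (v ∷ [])) ≡ r
      start-correct (yes hv) = sym (high-reach'-high hv v⇝r r-high)
      start-correct (no v≮)  = explore-correct s (v ∷ [])
        ([] ∷ [] , (≮⇒≥ v≮ , here (Low⇒≢r (≮⇒≥ v≮))) ∷ [] , Any.here refl) ≤-refl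

lemma4 : Σ ((s n : ℕ) → Fin n → Alg n (Fin n)) λ A →
    Σ ℕ λ c → Σ ℕ λ k →
    ∀ (s n : ℕ) (G : Graph n) → Forest G →
    (alive : Fin n → ℕ → Bool) → Partition.AliveSpec s G alive →
    (v r : Fin n) → Partition.IsSRootedRoot s G v r →
    proj₁ (run G alive (A s n v)) ≡ r × proj₂ (run G alive (A s n v)) ≤ c * suc s ^ k
lemma4 = RootSearch.findRoot , 4 , 3 , λ s n G forest alive spec v r isRoot →
  let open Semantics G alive in
  subst (λ p → proj₁ p ≡ r × proj₂ p ≤ 4 * suc s ^ 3) (sym (run-≡ (RootSearch.findRoot s n v)))
    (RootSearchCorrect.findRoot-correct forest spec isRoot , RootSearchCost.findRoot-cost s n G alive v)
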